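{- For $m\in\{2,4\}$ there exists a $3$-SCHGDD of type $(6,m^8)$.
   Context: Let $n,m,t$ be positive integers, $I_n=\{0,1,\dots,n-1\}$, $Z_{mt}$ the integers modulo $mt$, and $S=\{0,t,2t,\dots,(m-1)t\}\subseteq Z_{mt}$. A $3$-HGDD of type $(n,m^t)$ is a quadruple $(X,\mathcal G,\mathcal H,\mathcal B)$ where $X$ is a set of $nmt$ points, $\mathcal G$ is a partition of $X$ into $n$ groups of size $mt$, $\mathcal H$ is a partition of $X$ into $t$ holes of size $nm$ with $|H\cap G|=m$ for every $H\in\mathcal H$, $G\in\mathcal G$, and $\mathcal B$ is a collection of $3$-subsets of $X$ (blocks) such that no block contains two distinct points of the same group or of the same hole, while every other pair of distinct points of $X$ lies in exactly one block. A $3$-SCHGDD of type $(n,m^t)$ is a $3$-HGDD of type $(n,m^t)$ which, up to isomorphism, has $X=I_n\times Z_{mt}$, groups $\{i\}\times Z_{mt}$ ($i\in I_n$), holes $I_n\times(S+l)$ ($0\le l\le t-1$), and block set invariant under $(i,x)\mapsto (i,x+1 \bmod mt)$. -}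

module Defs where

open import Data.Nat using (ℕ; zero; suc; _*_; ∣_-_∣)
open import Data.Nat.Divisibility using (_∣_)
open import Data.Nat.DivMod using (_mod_)
open import Data.Fin using (Fin; toℕ)
open import Data.List using (List; length; lookup)
open import Data.Product using (_×_; _,_; Σ; proj₁; proj₂)
open import Data.Sum using (_⊎_)
open import Relation.Binary.PropositionalEquality using (_≡_; _≢_)
open import Relation.Nullary using (¬_)
open import Function.Bundles using (_⇔_)

-- Points of the canonical point set  X = I_n × Z_k  (here k = m t).
Point : ℕ → ℕ → Set
Point n k = Fin n × Fin k

-- Two elements of Z_{mt} lie in the same hole-column  S + l
-- (S = {0, t, ..., (m-1)t}) iff they are congruent modulo t.
SameHole : (t : ℕ) {k : ℕ} → Fin k → Fin k → Set
SameHole t x y = t ∣ ∣ toℕ x - toℕ y ∣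

SameGroup : {n k : ℕ} → Point n k → Point n k → Set
SameGroup p q = proj₁ p ≡ proj₁ q

-- A block {a, b, c} is represented by a triple (a , b , c).
Block : ℕ → ℕ → Set
Block n k = Point n k × Point n k × Point n k

_∈B_ : {n k : ℕ} → Point n k → Block n k → Set
p ∈B (a , b , c) = p ≡ a ⊎ p ≡ b ⊎ p ≡ c

SameSet : {n k : ℕ} → Block n k → Block n k → Set
SameSet {n} {k} B C = (p : Point n k) → (p ∈B B) ⇔ (p ∈B C)

-- A pair of distinct points is "admissible" (must be covered) iff the
-- points are in different groups and different holes.
Separated : (t : ℕ) {n k : ℕ} → Point n k → Point n k → Set
Separated t p q = ¬ SameGroup p q × ¬ SameHole t (proj₂ p) (proj₂ q)

-- Each block is a 3-subset containing no two distinct points of the same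
-- group or of the same hole (this also forces its three points distinct).
ValidBlock : (t : ℕ) {n k : ℕ} → Block n k → Set
ValidBlock t (a , b , c) = Separated t a b × Separated t a c × Separated t b c

sucMod : {k : ℕ} → Fin k → Fin k
sucMod {suc k} x = suc (toℕ x) mod suc k

shiftP : {n k : ℕ} → Point n k → Point n k
shiftP (i , x) = (i , sucMod x)

shiftB : {n k : ℕ} → Block n k → Block n k
shiftB (a , b , c) = (shiftP a , shiftP b , shiftP c)

-- A 3-SCHGDD of type (n, m^t), on the canonical point set
-- I_n × Z_{mt} with groups {i} × Z_{mt} and holes I_n × (S + l),
-- given by a finite list of blocks.
record SCHGDD (n m t : ℕ) : Set where
  field
    blocks : List (Block n (m * t))
    valid  : (i : Fin (length blocks)) → ValidBlock t (lookup blocks i)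
    cover  : (p q : Point n (m * t)) → p ≢ q → Separated t p q →
             Σ (Fin (length blocks)) λ i →
               (p ∈B lookup blocks i × q ∈B lookup blocks i) ×
               ((j : Fin (length blocks)) →
                  p ∈B lookup blocks j → q ∈B lookup blocks j → j ≡ i)
    cyclic : (i : Fin (length blocks)) →
             Σ (Fin (length blocks)) λ j →
               SameSet (lookup blocks j) (shiftB (lookup blocks i))

module Submission where

-- A 3-SCHGDD of type (6, m^8), m ∈ {2, 4}, is obtained by developing base
-- blocks cyclically modulo k = 8m.  The base blocks form a "difference
-- family": for every ordered pair of groups (a, b) and every d ∈ Z_k, the
-- number of ordered pairs of points ((a, y), (b, y')) inside a base block with
-- y' − y = d is 1 when (a, 0) and (b, d) may share a block (a ≠ b, 8 ∤ d) and
-- 0 otherwise.  The difference-family property is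
-- decidable; for the two concrete lists of base blocks the decision procedure
-- is run by the type checker, which gives lemma3p5.

open import Defs
open import Data.Empty using (⊥-elim)
open import Data.Fin as Fin using (Fin; toℕ; zero; suc; cast; #_)
open import Data.Fin.Properties
  using (toℕ-injective; toℕ-fromℕ<; toℕ<n; cast-involutive; *↔×; all?)
open import Data.List
  using (List; []; _∷_; length; lookup; tabulate; filter; cartesianProduct; allFin)
open import Data.List.Membership.Propositional using (_∈_)
open import Data.List.Membership.Propositional.Properties
  using (∈-filter⁺; ∈-filter⁻; ∈-cartesianProduct⁺; ∈-allFin)
open import Data.List.Properties using (length-tabulate; lookup-tabulate)
open import Data.List.Relation.Unary.Any using (here; there)
open import Data.Nat as ℕ using (ℕ; zero; suc; _+_; _*_; _∸_; _%_; _≤_; NonZero; ∣_-_∣)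
open import Data.Nat.DivMod using (_mod_; %-distribˡ-+; m%n%n≡m%n; [m+n]%n≡m%n; m<n⇒m%n≡m)
open import Data.Nat.Divisibility
  using (_∣_; _∣?_; n∣m*n; ∣m∣n⇒∣m+n; ∣m+n∣m⇒∣n; ∣n∣m%n⇒∣m; %-presˡ-∣)
open import Data.Nat.Properties
  using (+-comm; +-assoc; m∸n+n≡m; m+[n∸m]≡n; ≤-total; m≤n⇒∣m-n∣≡n∸m; ∣-∣-comm; <⇒≤)
open import Data.Product using (_×_; _,_; Σ; proj₁; proj₂)
open import Data.Product.Properties using (≡-dec)
open import Data.Sum using (_⊎_; inj₁; inj₂)
open import Data.Unit using (tt)
open import Function using (_∘_; id)
open import Function.Bundles using (_⇔_; mk⇔; _↔_; Inverse; Equivalence)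
open import Function.Construct.Composition using (_⇔-∘_)
open import Relation.Nullary using (¬_; Dec; yes; no; ¬?)
open import Relation.Nullary.Decidable using (_×-dec_; _→-dec_; toWitness)
open import Relation.Binary.PropositionalEquality
  using (_≡_; _≢_; refl; sym; trans; cong; cong₂; subst; module ≡-Reasoning)
open ≡-Reasoning

∣-+-multiple : ∀ {t a c} → t ∣ c → t ∣ a ⇔ t ∣ a + c
∣-+-multiple {t} {a} {c} t∣c = mk⇔ (λ t∣a → ∣m∣n⇒∣m+n t∣a t∣c)
  (λ t∣a+c → ∣m+n∣m⇒∣n (subst (t ∣_) (+-comm a c) t∣a+c) t∣c)

∣-complement : ∀ {t a b} → t ∣ a + b → t ∣ a ⇔ t ∣ b
∣-complement {t} {a} {b} t∣a+b = mk⇔ (∣m+n∣m⇒∣n t∣a+b)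
  (λ t∣b → ∣m+n∣m⇒∣n (subst (t ∣_) (+-comm a b) t∣a+b) t∣b)

∣⇔-cong : ∀ {t a a' b b'} → a ≡ a' → b ≡ b' → t ∣ a ⇔ t ∣ b → t ∣ a' ⇔ t ∣ b'
∣⇔-cong refl refl h = h

-- For x ≤ k and t ∣ k, the natural number w + (k ∸ x) represents w − x
-- modulo k, so it is divisible by t exactly when ∣ x − w ∣ is.
∣-dist⇔∣-shift : ∀ {t k x w} → t ∣ k → x ≤ k → t ∣ ∣ x - w ∣ ⇔ t ∣ w + (k ∸ x)
∣-dist⇔∣-shift {t} {k} {x} {w} t∣k x≤k with ≤-total x w
... | inj₁ x≤w =
  ∣⇔-cong (sym (m≤n⇒∣m-n∣≡n∸m x≤w)) shifted (∣-+-multiple t∣k)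
  where
    shifted : (w ∸ x) + k ≡ w + (k ∸ x)
    shifted = begin
      (w ∸ x) + k               ≡⟨ cong ((w ∸ x) +_) (sym (m+[n∸m]≡n x≤k)) ⟩
      (w ∸ x) + (x + (k ∸ x))   ≡⟨ sym (+-assoc (w ∸ x) x (k ∸ x)) ⟩
      (w ∸ x) + x + (k ∸ x)     ≡⟨ cong (_+ (k ∸ x)) (m∸n+n≡m x≤w) ⟩
      w + (k ∸ x)               ∎
... | inj₂ w≤x =
  ∣⇔-cong (sym (trans (∣-∣-comm x w) (m≤n⇒∣m-n∣≡n∸m w≤x))) refl
    (∣-complement (subst (t ∣_) (sym complement) t∣k))
  where
    complement : (x ∸ w) + (w + (k ∸ x)) ≡ k
    complement = begin
      (x ∸ w) + (w + (k ∸ x))   ≡⟨ sym (+-assoc (x ∸ w) w (k ∸ x)) ⟩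
      (x ∸ w) + w + (k ∸ x)     ≡⟨ cong (_+ (k ∸ x)) (m∸n+n≡m w≤x) ⟩
      x + (k ∸ x)               ≡⟨ m+[n∸m]≡n x≤k ⟩
      k                         ∎

toℕ-sucMod : ∀ {k} .{{_ : NonZero k}} (x : Fin k) → toℕ (sucMod x) ≡ suc (toℕ x) % k
toℕ-sucMod {suc _} x = toℕ-fromℕ< _

module ZMod (k : ℕ) .{{_ : NonZero k}} where

  infixl 6 _⊕_ _⊖_

  _⊕_ : Fin k → Fin k → Fin k
  x ⊕ y = (toℕ x + toℕ y) mod k

  _⊖_ : Fin k → Fin k → Fin k
  x ⊖ y = (toℕ x + (k ∸ toℕ y)) mod k

  toℕ-mod : ∀ a → toℕ (a mod k) ≡ a % k
  toℕ-mod a = toℕ-fromℕ< _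

  %-absorbˡ : ∀ a b → (a % k + b) % k ≡ (a + b) % k
  %-absorbˡ a b = begin
    (a % k + b) % k              ≡⟨ %-distribˡ-+ (a % k) b k ⟩
    (a % k % k + b % k) % k      ≡⟨ cong (λ z → (z + b % k) % k) (m%n%n≡m%n a k) ⟩
    (a % k + b % k) % k          ≡⟨ sym (%-distribˡ-+ a b k) ⟩
    (a + b) % k                  ∎

  %-absorbʳ : ∀ a b → (a + b % k) % k ≡ (a + b) % k
  %-absorbʳ a b = begin
    (a + b % k) % k   ≡⟨ cong (_% k) (+-comm a (b % k)) ⟩
    (b % k + a) % k   ≡⟨ %-absorbˡ b a ⟩
    (b + a) % k       ≡⟨ cong (_% k) (+-comm b a) ⟩
    (a + b) % k       ∎

  toℕ-% : ∀ (x : Fin k) → toℕ x % k ≡ toℕ x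
  toℕ-% x = m<n⇒m%n≡m (toℕ<n x)

  +k-% : ∀ (x : Fin k) → (toℕ x + k) % k ≡ toℕ x
  +k-% x = trans ([m+n]%n≡m%n (toℕ x) k) (toℕ-% x)

  ⊕-comm : ∀ x y → x ⊕ y ≡ y ⊕ x
  ⊕-comm x y = cong (_mod k) (+-comm (toℕ x) (toℕ y))

  ⊕-assoc : ∀ x y z → (x ⊕ y) ⊕ z ≡ x ⊕ (y ⊕ z)
  ⊕-assoc x y z = toℕ-injective (begin
    toℕ ((x ⊕ y) ⊕ z)                  ≡⟨ toℕ-mod _ ⟩
    (toℕ (x ⊕ y) + toℕ z) % k          ≡⟨ cong (λ a → (a + toℕ z) % k) (toℕ-mod _) ⟩
    ((toℕ x + toℕ y) % k + toℕ z) % k  ≡⟨ %-absorbˡ (toℕ x + toℕ y) (toℕ z) ⟩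
    (toℕ x + toℕ y + toℕ z) % k        ≡⟨ cong (_% k) (+-assoc (toℕ x) (toℕ y) (toℕ z)) ⟩
    (toℕ x + (toℕ y + toℕ z)) % k      ≡⟨ sym (%-absorbʳ (toℕ x) (toℕ y + toℕ z)) ⟩
    (toℕ x + (toℕ y + toℕ z) % k) % k  ≡⟨ cong (λ a → (toℕ x + a) % k) (sym (toℕ-mod _)) ⟩
    (toℕ x + toℕ (y ⊕ z)) % k          ≡⟨ sym (toℕ-mod _) ⟩
    toℕ (x ⊕ (y ⊕ z))                  ∎)

  ⊖-⊕ : ∀ w x → (w ⊖ x) ⊕ x ≡ w
  ⊖-⊕ w x = toℕ-injective (begin
    toℕ ((w ⊖ x) ⊕ x)                            ≡⟨ toℕ-mod _ ⟩
    (toℕ (w ⊖ x) + toℕ x) % k                    ≡⟨ cong (λ a → (a + toℕ x) % k) (toℕ-mod _) ⟩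
    ((toℕ w + (k ∸ toℕ x)) % k + toℕ x) % k      ≡⟨ %-absorbˡ _ (toℕ x) ⟩
    (toℕ w + (k ∸ toℕ x) + toℕ x) % k            ≡⟨ cong (_% k) (+-assoc (toℕ w) _ (toℕ x)) ⟩
    (toℕ w + ((k ∸ toℕ x) + toℕ x)) % k
      ≡⟨ cong (λ a → (toℕ w + a) % k) (m∸n+n≡m (<⇒≤ (toℕ<n x))) ⟩
    (toℕ w + k) % k                              ≡⟨ +k-% w ⟩
    toℕ w                                        ∎)

  ⊕-⊖ : ∀ s y → (s ⊕ y) ⊖ y ≡ s
  ⊕-⊖ s y = toℕ-injective (begin
    toℕ ((s ⊕ y) ⊖ y)                              ≡⟨ toℕ-mod _ ⟩
    (toℕ (s ⊕ y) + (k ∸ toℕ y)) % k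
      ≡⟨ cong (λ a → (a + (k ∸ toℕ y)) % k) (toℕ-mod _) ⟩
    ((toℕ s + toℕ y) % k + (k ∸ toℕ y)) % k        ≡⟨ %-absorbˡ _ (k ∸ toℕ y) ⟩
    (toℕ s + toℕ y + (k ∸ toℕ y)) % k              ≡⟨ cong (_% k) (+-assoc (toℕ s) (toℕ y) _) ⟩
    (toℕ s + (toℕ y + (k ∸ toℕ y))) % k
      ≡⟨ cong (λ a → (toℕ s + a) % k) (m+[n∸m]≡n (<⇒≤ (toℕ<n y))) ⟩
    (toℕ s + k) % k                                ≡⟨ +k-% s ⟩
    toℕ s                                          ∎)

  ⊕-⊖-⊕ : ∀ s w x → (s ⊕ w) ⊖ (s ⊕ x) ≡ w ⊖ x
  ⊕-⊖-⊕ s w x = begin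
    (s ⊕ w) ⊖ (s ⊕ x)                ≡⟨ cong (λ z → (s ⊕ z) ⊖ (s ⊕ x)) (sym (⊖-⊕ w x)) ⟩
    (s ⊕ ((w ⊖ x) ⊕ x)) ⊖ (s ⊕ x)    ≡⟨ cong (_⊖ (s ⊕ x)) (sym (⊕-assoc s (w ⊖ x) x)) ⟩
    ((s ⊕ (w ⊖ x)) ⊕ x) ⊖ (s ⊕ x)    ≡⟨ cong (λ z → (z ⊕ x) ⊖ (s ⊕ x)) (⊕-comm s (w ⊖ x)) ⟩
    (((w ⊖ x) ⊕ s) ⊕ x) ⊖ (s ⊕ x)    ≡⟨ cong (_⊖ (s ⊕ x)) (⊕-assoc (w ⊖ x) s x) ⟩
    ((w ⊖ x) ⊕ (s ⊕ x)) ⊖ (s ⊕ x)    ≡⟨ ⊕-⊖ (w ⊖ x) (s ⊕ x) ⟩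
    w ⊖ x                            ∎

  ⊖-injectiveˡ : ∀ {u w} x → u ⊖ x ≡ w ⊖ x → u ≡ w
  ⊖-injectiveˡ {u} {w} x eq = begin
    u              ≡⟨ sym (⊖-⊕ u x) ⟩
    (u ⊖ x) ⊕ x    ≡⟨ cong (_⊕ x) eq ⟩
    (w ⊖ x) ⊕ x    ≡⟨ ⊖-⊕ w x ⟩
    w              ∎

  translate-by-difference : ∀ {y y' x w} → y' ⊖ y ≡ w ⊖ x → (x ⊖ y) ⊕ y' ≡ w
  translate-by-difference {y} {y'} {x} {w} eq = ⊖-injectiveˡ x (begin
    ((x ⊖ y) ⊕ y') ⊖ x              ≡⟨ cong (((x ⊖ y) ⊕ y') ⊖_) (sym (⊖-⊕ x y)) ⟩
    ((x ⊖ y) ⊕ y') ⊖ ((x ⊖ y) ⊕ y)  ≡⟨ ⊕-⊖-⊕ (x ⊖ y) y' y ⟩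
    y' ⊖ y                          ≡⟨ eq ⟩
    w ⊖ x                           ∎)

  sucMod-⊕ : ∀ s y → sucMod (s ⊕ y) ≡ sucMod s ⊕ y
  sucMod-⊕ s y = toℕ-injective (begin
    toℕ (sucMod (s ⊕ y))               ≡⟨ toℕ-sucMod (s ⊕ y) ⟩
    (1 + toℕ (s ⊕ y)) % k              ≡⟨ cong (λ a → (1 + a) % k) (toℕ-mod _) ⟩
    (1 + (toℕ s + toℕ y) % k) % k      ≡⟨ %-absorbʳ 1 (toℕ s + toℕ y) ⟩
    (suc (toℕ s) + toℕ y) % k          ≡⟨ sym (%-absorbˡ (suc (toℕ s)) (toℕ y)) ⟩
    (suc (toℕ s) % k + toℕ y) % k      ≡⟨ cong (λ a → (a + toℕ y) % k) (sym (toℕ-sucMod s)) ⟩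
    (toℕ (sucMod s) + toℕ y) % k       ≡⟨ sym (toℕ-mod _) ⟩
    toℕ (sucMod s ⊕ y)                 ∎)

  sameHole⇔∣⊖ : ∀ {t} → t ∣ k → ∀ x w → SameHole t x w ⇔ t ∣ toℕ (w ⊖ x)
  sameHole⇔∣⊖ {t} t∣k x w = ∣⇔-cong refl (sym (toℕ-mod _))
    (mod-k⇔ ⇔-∘ ∣-dist⇔∣-shift t∣k (<⇒≤ (toℕ<n x)))
    where
      mod-k⇔ : ∀ {a} → t ∣ a ⇔ t ∣ a % k
      mod-k⇔ = mk⇔ (λ t∣a → %-presˡ-∣ t∣a t∣k) (∣n∣m%n⇒∣m t∣k)


pt : ∀ {n k} → Block n k → Fin 3 → Point n k
pt (a , _ , _) zero             = a
pt (_ , b , _) (suc zero)       = b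
pt (_ , _ , c) (suc (suc zero)) = c

position : ∀ {n k} {p : Point n k} B → p ∈B B → Σ (Fin 3) λ i → p ≡ pt B i
position B (inj₁ p≡a)        = zero , p≡a
position B (inj₂ (inj₁ p≡b)) = suc zero , p≡b
position B (inj₂ (inj₂ p≡c)) = suc (suc zero) , p≡c

at-position : ∀ {n k} {p : Point n k} B i → p ≡ pt B i → p ∈B B
at-position B zero             p≡a = inj₁ p≡a
at-position B (suc zero)       p≡b = inj₂ (inj₁ p≡b)
at-position B (suc (suc zero)) p≡c = inj₂ (inj₂ p≡c)

data Arc : Set where
  arc01 arc02 arc10 arc12 arc20 arc21 : Arc

src tgt : Arc → Fin 3
src arc01 = zero
src arc02 = zero
src arc10 = suc zero
src arc12 = suc zero
src arc20 = suc (suc zero)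
src arc21 = suc (suc zero)
tgt arc01 = suc zero
tgt arc02 = suc (suc zero)
tgt arc10 = zero
tgt arc12 = suc (suc zero)
tgt arc20 = zero
tgt arc21 = suc zero

arcs : List Arc
arcs = arc01 ∷ arc02 ∷ arc10 ∷ arc12 ∷ arc20 ∷ arc21 ∷ []

∈-arcs : ∀ α → α ∈ arcs
∈-arcs arc01 = here refl
∈-arcs arc02 = there (here refl)
∈-arcs arc10 = there (there (here refl))
∈-arcs arc12 = there (there (there (here refl)))
∈-arcs arc20 = there (there (there (there (here refl))))
∈-arcs arc21 = there (there (there (there (there (here refl)))))

arc-between : ∀ {i j : Fin 3} → i ≢ j → Σ Arc λ α → src α ≡ i × tgt α ≡ j
arc-between {zero}           {zero}           i≢j = ⊥-elim (i≢j refl)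
arc-between {zero}           {suc zero}       _   = arc01 , refl , refl
arc-between {zero}           {suc (suc zero)} _   = arc02 , refl , refl
arc-between {suc zero}       {zero}           _   = arc10 , refl , refl
arc-between {suc zero}       {suc zero}       i≢j = ⊥-elim (i≢j refl)
arc-between {suc zero}       {suc (suc zero)} _   = arc12 , refl , refl
arc-between {suc (suc zero)} {zero}           _   = arc20 , refl , refl
arc-between {suc (suc zero)} {suc zero}       _   = arc21 , refl , refl
arc-between {suc (suc zero)} {suc (suc zero)} i≢j = ⊥-elim (i≢j refl)

UniqueCover : (t : ℕ) {n k : ℕ} {I : Set} → (I → Block n k) → Set
UniqueCover t {n} {k} {I} F =
  (p q : Point n k) → p ≢ q → Separated t p q →
  Σ I λ i → (p ∈B F i × q ∈B F i) × (∀ j → p ∈B F j → q ∈B F j → j ≡ i)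

ShiftClosed : {n k : ℕ} {I : Set} → (I → Block n k) → Set
ShiftClosed {I = I} F = ∀ i → Σ I λ j → F j ≡ shiftB (F i)

schgdd-from-family : ∀ {n m t N} {I : Set} → Fin N ↔ I → (F : I → Block n (m * t)) →
                     (∀ i → ValidBlock t (F i)) → UniqueCover t F → ShiftClosed F →
                     SCHGDD n m t
schgdd-from-family {n} {m} {t} {N} {I} enum F valid cover closed = record
  { blocks = blocks
  ; valid  = λ ι → subst (ValidBlock t) (sym (lookup-index ι)) (valid (index ι))
  ; cover  = λ p q p≢q sep →
      let (i , (p∈ , q∈) , unique) = cover p q p≢q sep
      in position-of i
       , (subst (p ∈B_) (sym (lookup-position i)) p∈ , subst (q ∈B_) (sym (lookup-position i)) q∈)
       , λ ι p∈ι q∈ι → begin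
           ι                        ≡⟨ sym (position-index ι) ⟩
           position-of (index ι)    ≡⟨ cong position-of (unique (index ι)
                                         (subst (p ∈B_) (lookup-index ι) p∈ι)
                                         (subst (q ∈B_) (lookup-index ι) q∈ι)) ⟩
           position-of i            ∎
  ; cyclic = λ ι →
      let (j , Fj≡shift) = closed (index ι)
      in position-of j , ≡⇒SameSet (begin
           lookup blocks (position-of j)   ≡⟨ lookup-position j ⟩
           F j                             ≡⟨ Fj≡shift ⟩
           shiftB (F (index ι))            ≡⟨ cong shiftB (sym (lookup-index ι)) ⟩
           shiftB (lookup blocks ι)        ∎)
  }
  where
    open Inverse enum using (to; from; strictlyInverseˡ; strictlyInverseʳ)
    blocks : List (Block n (m * t))
    blocks = tabulate (F ∘ to)

    length≡ : length blocks ≡ N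
    length≡ = length-tabulate (F ∘ to)

    index : Fin (length blocks) → I
    index ι = to (cast length≡ ι)

    position-of : I → Fin (length blocks)
    position-of i = cast (sym length≡) (from i)

    lookup-index : ∀ ι → lookup blocks ι ≡ F (index ι)
    lookup-index ι = trans (cong (lookup blocks) (sym (cast-involutive (sym length≡) length≡ ι)))
                           (lookup-tabulate (F ∘ to) (cast length≡ ι))

    index-position : ∀ i → index (position-of i) ≡ i
    index-position i = trans (cong to (cast-involutive length≡ (sym length≡) (from i))) (strictlyInverseˡ i)

    position-index : ∀ ι → position-of (index ι) ≡ ι
    position-index ι = trans (cong (cast (sym length≡)) (strictlyInverseʳ (cast length≡ ι)))
                             (cast-involutive (sym length≡) length≡ ι)

    lookup-position : ∀ i → lookup blocks (position-of i) ≡ F i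
    lookup-position i = trans (lookup-index (position-of i)) (cong F (index-position i))

    ≡⇒SameSet : ∀ {B C} → B ≡ C → SameSet B C
    ≡⇒SameSet refl p = mk⇔ id id

module _ {A : Set} {P : A → Set} where

  unique-solution : ∀ {L} → (∀ x → x ∈ L ⇔ P x) → length L ≡ 1 →
                    Σ A λ x → P x × (∀ y → P y → y ≡ x)
  unique-solution {z ∷ []} members _ =
    z , Equivalence.to (members z) (here refl) , λ y Py → singleton (Equivalence.from (members y) Py)
    where
      singleton : ∀ {y} → y ∈ z ∷ [] → y ≡ z
      singleton (here y≡z) = y≡z

  no-solution : ∀ {L} → (∀ x → x ∈ L ⇔ P x) → length L ≡ 0 → ∀ x → ¬ P x
  no-solution {[]} members _ x Px with () ← Equivalence.from (members x) Px

module Development (n m t : ℕ) .{{_ : NonZero (m * t)}} (base : List (Block n (m * t))) where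

  open ZMod (m * t)

  R : ℕ
  R = length base

  translate : Fin (m * t) → Point n (m * t) → Point n (m * t)
  translate s (g , y) = (g , s ⊕ y)

  develop : Fin R → Fin (m * t) → Block n (m * t)
  develop r s = let (a , b , c) = lookup base r in (translate s a , translate s b , translate s c)

  pt-develop : ∀ r s i → pt (develop r s) i ≡ translate s (pt (lookup base r) i)
  pt-develop r s zero             = refl
  pt-develop r s (suc zero)       = refl
  pt-develop r s (suc (suc zero)) = refl

  Difference : Set
  Difference = Fin n × Fin n × Fin (m * t)

  difference : Point n (m * t) → Point n (m * t) → Difference
  difference (a , x) (b , w) = (a , b , w ⊖ x)

  groups : Difference → Fin n × Fin n
  groups (a , b , _) = (a , b)

  amount : Difference → Fin (m * t)
  amount (_ , _ , d) = d

  Admissible : Difference → Set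
  Admissible (a , b , d) = a ≢ b × ¬ t ∣ toℕ d

  separated⇔admissible : ∀ p q → Separated t p q ⇔ Admissible (difference p q)
  separated⇔admissible (a , x) (b , w) =
    mk⇔ (λ (a≢b , x≁w) → a≢b , x≁w ∘ from) (λ (a≢b , ¬t∣d) → a≢b , ¬t∣d ∘ to)
    where open Equivalence (sameHole⇔∣⊖ (n∣m*n m) x w)

  difference-translate : ∀ s p q → difference (translate s p) (translate s q) ≡ difference p q
  difference-translate s (a , x) (b , w) = cong (λ d → a , b , d) (⊕-⊖-⊕ s w x)

  translation-unique : ∀ {s p u} → p ≡ translate s u → s ≡ proj₂ p ⊖ proj₂ u
  translation-unique {s} {u = (g , y)} refl = sym (⊕-⊖ s y)

  translate-onto : ∀ {u v p q} → difference u v ≡ difference p q →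
                   let s = proj₂ p ⊖ proj₂ u in p ≡ translate s u × q ≡ translate s v
  translate-onto {g , y} {g' , y'} {a , x} {b , w} eq =
    cong₂ _,_ (sym (cong (proj₁ ∘ groups) eq)) (sym (⊖-⊕ x y)) ,
    cong₂ _,_ (sym (cong (proj₂ ∘ groups) eq))
              (sym (translate-by-difference {y} {y'} {x} {w} (cong amount eq)))

  Occurrence : Set
  Occurrence = Fin R × Arc

  start end : Occurrence → Point n (m * t)
  start (r , α) = pt (lookup base r) (src α)
  end (r , α) = pt (lookup base r) (tgt α)

  Δ : Occurrence → Difference
  Δ e = difference (start e) (end e)

  OccursOnce : Difference → Set
  OccursOnce τ = Σ Occurrence λ e → Δ e ≡ τ × (∀ e' → Δ e' ≡ τ → e' ≡ e)

  record DifferenceFamily : Set where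
    field
      admissible : ∀ e → Admissible (Δ e)
      unique     : ∀ τ → Admissible τ → OccursOnce τ

  ∈-develop : ∀ {p} r s i → p ≡ translate s (pt (lookup base r) i) → p ∈B develop r s
  ∈-develop r s i p≡ = at-position (develop r s) i (trans p≡ (sym (pt-develop r s i)))

  occurrence-of-pair : ∀ {p q} r s → p ≢ q → p ∈B develop r s → q ∈B develop r s →
                       Σ Arc λ α → p ≡ translate s (start (r , α)) × q ≡ translate s (end (r , α))
  occurrence-of-pair {p} {q} r s p≢q p∈ q∈ =
    let (α , src≡i , tgt≡j) = arc-between i≢j
    in α , subst (λ i' → p ≡ image i') (sym src≡i) p-at
         , subst (λ j' → q ≡ image j') (sym tgt≡j) q-at
    where
      image : Fin 3 → Point n (m * t)
      image i = translate s (pt (lookup base r) i)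
      i = proj₁ (position (develop r s) p∈)
      j = proj₁ (position (develop r s) q∈)
      p-at : p ≡ image i
      p-at = trans (proj₂ (position (develop r s) p∈)) (pt-develop r s i)
      q-at : q ≡ image j
      q-at = trans (proj₂ (position (develop r s) q∈)) (pt-develop r s j)
      i≢j : i ≢ j
      i≢j i≡j = p≢q (trans p-at (trans (cong image i≡j) (sym q-at)))

  Δ-translates : ∀ {p q} e s → p ≡ translate s (start e) → q ≡ translate s (end e) →
                 Δ e ≡ difference p q
  Δ-translates e s refl refl = sym (difference-translate s (start e) (end e))

  module _ (family : DifferenceFamily) where
    open DifferenceFamily family

    develop-valid : ∀ r s → ValidBlock t (develop r s)
    develop-valid r s = separated arc01 , separated arc02 , separated arc12
      where
        separated : ∀ α → Separated t (translate s (start (r , α))) (translate s (end (r , α)))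
        separated α = Equivalence.from (separated⇔admissible u v)
          (subst Admissible (Δ-translates (r , α) s refl refl) (admissible (r , α)))
          where
            u = translate s (start (r , α))
            v = translate s (end (r , α))

    develop-shift : ∀ r s → develop r (sucMod s) ≡ shiftB (develop r s)
    develop-shift r s = let (a , b , c) = lookup base r in
      cong₂ _,_ (shift-translate a) (cong₂ _,_ (shift-translate b) (shift-translate c))
      where
        shift-translate : ∀ u → translate (sucMod s) u ≡ shiftP (translate s u)
        shift-translate (g , y) = cong (g ,_) (sym (sucMod-⊕ s y))

    -- The block through p and q is base[r] + (p − start e), where e = (r , α)
    -- is the unique occurrence of the difference of p and q; any block
    -- base[r'] + s' through p and q yields an occurrence of that same
    -- difference, hence r' = r, and then s' is forced by p.
    develop-cover : UniqueCover t (λ (rs : Fin R × Fin (m * t)) → develop (proj₁ rs) (proj₂ rs))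
    develop-cover p q p≢q sep = (r , s) , (p∈ , q∈) , only
      where
        found = unique (difference p q) (Equivalence.to (separated⇔admissible p q) sep)
        e = proj₁ found
        r = proj₁ e
        s = proj₂ p ⊖ proj₂ (start e)
        onto = translate-onto {start e} {end e} {p} {q} (proj₁ (proj₂ found))
        p∈ = ∈-develop r s (src (proj₂ e)) (proj₁ onto)
        q∈ = ∈-develop r s (tgt (proj₂ e)) (proj₂ onto)

        only : ∀ rs' → p ∈B develop (proj₁ rs') (proj₂ rs') →
               q ∈B develop (proj₁ rs') (proj₂ rs') → rs' ≡ (r , s)
        only (r' , s') p∈' q∈' =
          let (α' , p≡ , q≡) = occurrence-of-pair r' s' p≢q p∈' q∈'
              e'≡e = proj₂ (proj₂ found) (r' , α') (Δ-translates (r' , α') s' p≡ q≡)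
          in cong₂ _,_ (cong proj₁ e'≡e)
                       (trans (translation-unique p≡) (cong (λ u → proj₂ p ⊖ proj₂ (start u)) e'≡e))

    development-is-SCHGDD : SCHGDD n m t
    development-is-SCHGDD =
      schgdd-from-family *↔× (λ (rs : Fin R × Fin (m * t)) → develop (proj₁ rs) (proj₂ rs))
        (λ (r , s) → develop-valid r s) develop-cover
        (λ (r , s) → (r , sucMod s) , develop-shift r s)

  -- Deciding the difference-family property.  The occurrences are first
  -- bucketed by their pair of groups, so that counting the occurrences of a
  -- difference only scans one bucket.
  occurrences : List Occurrence
  occurrences = cartesianProduct (allFin R) arcs

  ∈-occurrences : ∀ e → e ∈ occurrences
  ∈-occurrences (r , α) = ∈-cartesianProduct⁺ (∈-allFin r) (∈-arcs α)

  inGroups? : ∀ a b e → Dec (groups (Δ e) ≡ (a , b))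
  inGroups? a b e = ≡-dec Fin._≟_ Fin._≟_ (groups (Δ e)) (a , b)

  ofAmount? : ∀ d e → Dec (amount (Δ e) ≡ d)
  ofAmount? d e = amount (Δ e) Fin.≟ d

  bucket : Fin n → Fin n → List Occurrence
  bucket a b = filter (inGroups? a b) occurrences

  hits : Fin (m * t) → List Occurrence → List Occurrence
  hits d = filter (ofAmount? d)

  ∈-hits : ∀ a b d e → e ∈ hits d (bucket a b) ⇔ Δ e ≡ (a , b , d)
  ∈-hits a b d e = mk⇔
    (λ e∈ → let (e∈bucket , amount≡d) = ∈-filter⁻ (ofAmount? d) {xs = bucket a b} e∈
            in cong₂ (λ g d → proj₁ g , proj₂ g , d)
                 (proj₂ (∈-filter⁻ (inGroups? a b) {xs = occurrences} e∈bucket)) amount≡d)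
    (λ Δe≡ → ∈-filter⁺ (ofAmount? d)
               (∈-filter⁺ (inGroups? a b) (∈-occurrences e) (cong groups Δe≡))
               (cong amount Δe≡))

  CountsRight : Difference → List Occurrence → Set
  CountsRight τ L = (Admissible τ → length L ≡ 1) × (¬ Admissible τ → length L ≡ 0)

  BucketCorrect : Fin n → Fin n → List Occurrence → Set
  BucketCorrect a b L = ∀ d → CountsRight (a , b , d) (hits d L)

  CountsCorrect : Set
  CountsCorrect = ∀ a b → BucketCorrect a b (bucket a b)

  admissible? : ∀ τ → Dec (Admissible τ)
  admissible? (a , b , d) = ¬? (a Fin.≟ b) ×-dec ¬? (t ∣? toℕ d)

  countsCorrect? : Dec CountsCorrect
  countsCorrect? = all? λ a → all? λ b → bucketCorrect? a b (bucket a b)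
    where
      bucketCorrect? : ∀ a b L → Dec (BucketCorrect a b L)
      bucketCorrect? a b L = all? λ d →
        let L' = hits d L; admissible = admissible? (a , b , d) in
        (admissible →-dec length L' ℕ.≟ 1) ×-dec (¬? admissible →-dec length L' ℕ.≟ 0)

  countsCorrect⇒family : CountsCorrect → DifferenceFamily
  countsCorrect⇒family correct = record { admissible = admissible ; unique = unique }
    where
      admissible : ∀ e → Admissible (Δ e)
      admissible e with admissible? (Δ e)
      ... | yes adm = adm
      ... | no ¬adm = ⊥-elim (no-solution (∈-hits a b d) (proj₂ (correct a b d) ¬adm) e refl)
        where
          a = proj₁ (groups (Δ e))
          b = proj₂ (groups (Δ e))
          d = amount (Δ e)

      unique : ∀ τ → Admissible τ → OccursOnce τ
      unique (a , b , d) adm = unique-solution (∈-hits a b d) (proj₁ (correct a b d) adm)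

base₂ : List (Block 6 16)
base₂ =
  ((# 0 , # 0) , (# 1 , # 14) , (# 4 , # 5)) ∷ ((# 1 , # 0) , (# 2 , # 10) , (# 5 , # 6))
  ∷ ((# 0 , # 0) , (# 2 , # 13) , (# 5 , # 2)) ∷ ((# 0 , # 0) , (# 2 , # 9) , (# 4 , # 10))
  ∷ ((# 0 , # 0) , (# 4 , # 2) , (# 5 , # 3)) ∷ ((# 0 , # 0) , (# 1 , # 6) , (# 5 , # 15))
  ∷ ((# 0 , # 0) , (# 1 , # 4) , (# 3 , # 6)) ∷ ((# 0 , # 0) , (# 1 , # 10) , (# 5 , # 11))
  ∷ ((# 0 , # 0) , (# 1 , # 2) , (# 2 , # 1)) ∷ ((# 0 , # 0) , (# 1 , # 12) , (# 2 , # 5))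
  ∷ ((# 0 , # 0) , (# 1 , # 13) , (# 5 , # 7)) ∷ ((# 0 , # 0) , (# 1 , # 11) , (# 5 , # 9))
  ∷ ((# 0 , # 0) , (# 2 , # 12) , (# 3 , # 7)) ∷ ((# 0 , # 0) , (# 2 , # 10) , (# 3 , # 15))
  ∷ ((# 0 , # 0) , (# 3 , # 9) , (# 4 , # 6)) ∷ ((# 0 , # 0) , (# 1 , # 3) , (# 4 , # 7))
  ∷ ((# 0 , # 0) , (# 2 , # 15) , (# 3 , # 1)) ∷ ((# 0 , # 0) , (# 3 , # 11) , (# 4 , # 12))
  ∷ ((# 0 , # 0) , (# 3 , # 14) , (# 5 , # 5)) ∷ ((# 0 , # 0) , (# 1 , # 15) , (# 3 , # 3))
  ∷ ((# 0 , # 0) , (# 1 , # 5) , (# 2 , # 2)) ∷ ((# 0 , # 0) , (# 2 , # 14) , (# 4 , # 13))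
  ∷ ((# 0 , # 0) , (# 3 , # 10) , (# 5 , # 12)) ∷ ((# 0 , # 0) , (# 2 , # 3) , (# 5 , # 4))
  ∷ ((# 0 , # 0) , (# 2 , # 11) , (# 4 , # 14)) ∷ ((# 0 , # 0) , (# 1 , # 7) , (# 4 , # 9))
  ∷ ((# 0 , # 0) , (# 3 , # 13) , (# 4 , # 1)) ∷ ((# 0 , # 0) , (# 3 , # 12) , (# 5 , # 6))
  ∷ ((# 0 , # 0) , (# 4 , # 15) , (# 5 , # 10)) ∷ ((# 0 , # 0) , (# 4 , # 3) , (# 5 , # 13))
  ∷ ((# 0 , # 0) , (# 2 , # 6) , (# 3 , # 4)) ∷ ((# 0 , # 0) , (# 1 , # 1) , (# 2 , # 7))
  ∷ ((# 0 , # 0) , (# 3 , # 5) , (# 4 , # 4)) ∷ ((# 0 , # 0) , (# 1 , # 9) , (# 2 , # 4))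
  ∷ ((# 0 , # 0) , (# 3 , # 2) , (# 5 , # 1)) ∷ ((# 0 , # 0) , (# 4 , # 11) , (# 5 , # 14))
  ∷ ((# 1 , # 0) , (# 2 , # 3) , (# 3 , # 13)) ∷ ((# 1 , # 0) , (# 3 , # 12) , (# 5 , # 15))
  ∷ ((# 2 , # 0) , (# 3 , # 3) , (# 5 , # 14)) ∷ ((# 1 , # 0) , (# 3 , # 9) , (# 4 , # 12))
  ∷ ((# 1 , # 0) , (# 3 , # 10) , (# 4 , # 3)) ∷ ((# 1 , # 0) , (# 3 , # 5) , (# 4 , # 1))
  ∷ ((# 1 , # 0) , (# 4 , # 10) , (# 5 , # 7)) ∷ ((# 2 , # 0) , (# 3 , # 6) , (# 4 , # 12))
  ∷ ((# 1 , # 0) , (# 3 , # 3) , (# 4 , # 14)) ∷ ((# 2 , # 0) , (# 4 , # 10) , (# 5 , # 9))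
  ∷ ((# 1 , # 0) , (# 2 , # 12) , (# 5 , # 2)) ∷ ((# 2 , # 0) , (# 3 , # 12) , (# 5 , # 13))
  ∷ ((# 1 , # 0) , (# 2 , # 5) , (# 5 , # 12)) ∷ ((# 2 , # 0) , (# 3 , # 1) , (# 4 , # 6))
  ∷ ((# 1 , # 0) , (# 4 , # 11) , (# 5 , # 4)) ∷ ((# 2 , # 0) , (# 3 , # 9) , (# 5 , # 2))
  ∷ ((# 3 , # 0) , (# 4 , # 7) , (# 5 , # 12)) ∷ ((# 1 , # 0) , (# 2 , # 2) , (# 3 , # 1))
  ∷ ((# 1 , # 0) , (# 3 , # 6) , (# 5 , # 11)) ∷ ((# 1 , # 0) , (# 2 , # 7) , (# 3 , # 14))
  ∷ ((# 2 , # 0) , (# 3 , # 13) , (# 5 , # 10)) ∷ ((# 2 , # 0) , (# 4 , # 4) , (# 5 , # 11))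
  ∷ ((# 1 , # 0) , (# 2 , # 1) , (# 4 , # 6)) ∷ ((# 2 , # 0) , (# 4 , # 7) , (# 5 , # 3))
  ∷ ((# 2 , # 0) , (# 4 , # 13) , (# 5 , # 15)) ∷ ((# 2 , # 0) , (# 3 , # 4) , (# 4 , # 2))
  ∷ ((# 1 , # 0) , (# 2 , # 14) , (# 4 , # 9)) ∷ ((# 2 , # 0) , (# 4 , # 14) , (# 5 , # 4))
  ∷ ((# 1 , # 0) , (# 2 , # 4) , (# 4 , # 13)) ∷ ((# 1 , # 0) , (# 3 , # 11) , (# 4 , # 5))
  ∷ ((# 1 , # 0) , (# 3 , # 15) , (# 5 , # 3)) ∷ ((# 1 , # 0) , (# 4 , # 15) , (# 5 , # 13))
  ∷ ((# 1 , # 0) , (# 3 , # 7) , (# 5 , # 5)) ∷ ((# 3 , # 0) , (# 4 , # 2) , (# 5 , # 6)) ∷ []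

base₄ : List (Block 6 32)
base₄ =
  ((# 0 , # 0) , (# 4 , # 29) , (# 5 , # 10)) ∷ ((# 1 , # 0) , (# 4 , # 3) , (# 5 , # 1))
  ∷ ((# 0 , # 0) , (# 1 , # 9) , (# 5 , # 18)) ∷ ((# 0 , # 0) , (# 1 , # 13) , (# 4 , # 31))
  ∷ ((# 1 , # 0) , (# 3 , # 3) , (# 5 , # 12)) ∷ ((# 0 , # 0) , (# 1 , # 19) , (# 2 , # 7))
  ∷ ((# 0 , # 0) , (# 1 , # 3) , (# 4 , # 5)) ∷ ((# 0 , # 0) , (# 1 , # 12) , (# 4 , # 18))
  ∷ ((# 0 , # 0) , (# 1 , # 30) , (# 4 , # 28)) ∷ ((# 0 , # 0) , (# 1 , # 26) , (# 5 , # 19))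
  ∷ ((# 0 , # 0) , (# 1 , # 29) , (# 5 , # 14)) ∷ ((# 0 , # 0) , (# 1 , # 11) , (# 5 , # 15))
  ∷ ((# 1 , # 0) , (# 2 , # 13) , (# 4 , # 22)) ∷ ((# 0 , # 0) , (# 1 , # 17) , (# 4 , # 22))
  ∷ ((# 0 , # 0) , (# 1 , # 1) , (# 5 , # 3)) ∷ ((# 3 , # 0) , (# 4 , # 15) , (# 5 , # 4))
  ∷ ((# 2 , # 0) , (# 4 , # 31) , (# 5 , # 4)) ∷ ((# 1 , # 0) , (# 4 , # 14) , (# 5 , # 11))
  ∷ ((# 0 , # 0) , (# 3 , # 3) , (# 4 , # 4)) ∷ ((# 1 , # 0) , (# 3 , # 6) , (# 4 , # 26))
  ∷ ((# 1 , # 0) , (# 2 , # 19) , (# 4 , # 10)) ∷ ((# 0 , # 0) , (# 2 , # 27) , (# 4 , # 20))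
  ∷ ((# 0 , # 0) , (# 1 , # 25) , (# 2 , # 3)) ∷ ((# 1 , # 0) , (# 3 , # 31) , (# 4 , # 29))
  ∷ ((# 0 , # 0) , (# 4 , # 12) , (# 5 , # 23)) ∷ ((# 1 , # 0) , (# 2 , # 5) , (# 5 , # 28))
  ∷ ((# 1 , # 0) , (# 3 , # 30) , (# 5 , # 20)) ∷ ((# 1 , # 0) , (# 4 , # 21) , (# 5 , # 7))
  ∷ ((# 1 , # 0) , (# 3 , # 13) , (# 4 , # 17)) ∷ ((# 0 , # 0) , (# 1 , # 5) , (# 3 , # 7))
  ∷ ((# 0 , # 0) , (# 1 , # 21) , (# 3 , # 10)) ∷ ((# 1 , # 0) , (# 4 , # 25) , (# 5 , # 29))
  ∷ ((# 1 , # 0) , (# 2 , # 21) , (# 4 , # 27)) ∷ ((# 1 , # 0) , (# 2 , # 27) , (# 4 , # 9))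
  ∷ ((# 0 , # 0) , (# 1 , # 28) , (# 3 , # 5)) ∷ ((# 0 , # 0) , (# 1 , # 15) , (# 3 , # 30))
  ∷ ((# 1 , # 0) , (# 2 , # 22) , (# 5 , # 5)) ∷ ((# 0 , # 0) , (# 1 , # 20) , (# 2 , # 29))
  ∷ ((# 1 , # 0) , (# 2 , # 6) , (# 5 , # 13)) ∷ ((# 0 , # 0) , (# 1 , # 4) , (# 4 , # 11))
  ∷ ((# 1 , # 0) , (# 2 , # 14) , (# 3 , # 12)) ∷ ((# 1 , # 0) , (# 3 , # 23) , (# 4 , # 1))
  ∷ ((# 1 , # 0) , (# 2 , # 30) , (# 4 , # 13)) ∷ ((# 1 , # 0) , (# 3 , # 10) , (# 5 , # 30))
  ∷ ((# 1 , # 0) , (# 2 , # 18) , (# 3 , # 1)) ∷ ((# 1 , # 0) , (# 2 , # 28) , (# 4 , # 23))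
  ∷ ((# 1 , # 0) , (# 3 , # 27) , (# 5 , # 22)) ∷ ((# 1 , # 0) , (# 2 , # 11) , (# 3 , # 18))
  ∷ ((# 1 , # 0) , (# 2 , # 4) , (# 3 , # 25)) ∷ ((# 1 , # 0) , (# 2 , # 25) , (# 4 , # 15))
  ∷ ((# 1 , # 0) , (# 3 , # 26) , (# 5 , # 23)) ∷ ((# 1 , # 0) , (# 2 , # 12) , (# 3 , # 5))
  ∷ ((# 1 , # 0) , (# 2 , # 31) , (# 3 , # 22)) ∷ ((# 0 , # 0) , (# 1 , # 6) , (# 5 , # 5))
  ∷ ((# 1 , # 0) , (# 2 , # 3) , (# 5 , # 15)) ∷ ((# 1 , # 0) , (# 2 , # 7) , (# 3 , # 17))
  ∷ ((# 1 , # 0) , (# 4 , # 28) , (# 5 , # 6)) ∷ ((# 0 , # 0) , (# 1 , # 23) , (# 4 , # 2))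
  ∷ ((# 0 , # 0) , (# 1 , # 14) , (# 3 , # 21)) ∷ ((# 1 , # 0) , (# 4 , # 12) , (# 5 , # 27))
  ∷ ((# 1 , # 0) , (# 2 , # 23) , (# 5 , # 19)) ∷ ((# 0 , # 0) , (# 1 , # 27) , (# 3 , # 31))
  ∷ ((# 0 , # 0) , (# 1 , # 2) , (# 4 , # 1)) ∷ ((# 0 , # 0) , (# 1 , # 10) , (# 2 , # 4))
  ∷ ((# 0 , # 0) , (# 1 , # 18) , (# 5 , # 4)) ∷ ((# 1 , # 0) , (# 2 , # 1) , (# 3 , # 20))
  ∷ ((# 0 , # 0) , (# 1 , # 31) , (# 5 , # 13)) ∷ ((# 1 , # 0) , (# 2 , # 29) , (# 3 , # 28))
  ∷ ((# 0 , # 0) , (# 1 , # 22) , (# 5 , # 25)) ∷ ((# 1 , # 0) , (# 3 , # 19) , (# 5 , # 21))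
  ∷ ((# 1 , # 0) , (# 3 , # 14) , (# 5 , # 10)) ∷ ((# 0 , # 0) , (# 1 , # 7) , (# 4 , # 26))
  ∷ ((# 1 , # 0) , (# 2 , # 2) , (# 4 , # 4)) ∷ ((# 1 , # 0) , (# 2 , # 17) , (# 3 , # 29))
  ∷ ((# 1 , # 0) , (# 3 , # 11) , (# 5 , # 26)) ∷ ((# 1 , # 0) , (# 2 , # 15) , (# 4 , # 20))
  ∷ ((# 2 , # 0) , (# 3 , # 28) , (# 4 , # 10)) ∷ ((# 0 , # 0) , (# 2 , # 26) , (# 4 , # 13))
  ∷ ((# 0 , # 0) , (# 2 , # 21) , (# 5 , # 22)) ∷ ((# 0 , # 0) , (# 2 , # 9) , (# 5 , # 26))
  ∷ ((# 0 , # 0) , (# 2 , # 5) , (# 3 , # 11)) ∷ ((# 0 , # 0) , (# 3 , # 20) , (# 4 , # 25))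
  ∷ ((# 0 , # 0) , (# 2 , # 15) , (# 3 , # 12)) ∷ ((# 0 , # 0) , (# 3 , # 9) , (# 5 , # 28))
  ∷ ((# 0 , # 0) , (# 2 , # 30) , (# 5 , # 27)) ∷ ((# 0 , # 0) , (# 3 , # 25) , (# 4 , # 14))
  ∷ ((# 0 , # 0) , (# 2 , # 17) , (# 4 , # 15)) ∷ ((# 0 , # 0) , (# 3 , # 2) , (# 4 , # 19))
  ∷ ((# 3 , # 0) , (# 4 , # 29) , (# 5 , # 17)) ∷ ((# 3 , # 0) , (# 4 , # 28) , (# 5 , # 10))
  ∷ ((# 2 , # 0) , (# 3 , # 5) , (# 4 , # 12)) ∷ ((# 0 , # 0) , (# 2 , # 12) , (# 5 , # 6))
  ∷ ((# 0 , # 0) , (# 3 , # 28) , (# 4 , # 23)) ∷ ((# 0 , # 0) , (# 4 , # 6) , (# 5 , # 12))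
  ∷ ((# 0 , # 0) , (# 3 , # 29) , (# 5 , # 11)) ∷ ((# 0 , # 0) , (# 3 , # 6) , (# 5 , # 17))
  ∷ ((# 0 , # 0) , (# 2 , # 2) , (# 5 , # 1)) ∷ ((# 0 , # 0) , (# 2 , # 22) , (# 3 , # 26))
  ∷ ((# 0 , # 0) , (# 2 , # 25) , (# 5 , # 30)) ∷ ((# 0 , # 0) , (# 3 , # 17) , (# 4 , # 3))
  ∷ ((# 0 , # 0) , (# 3 , # 19) , (# 4 , # 10)) ∷ ((# 0 , # 0) , (# 2 , # 31) , (# 3 , # 13))
  ∷ ((# 0 , # 0) , (# 2 , # 19) , (# 3 , # 22)) ∷ ((# 0 , # 0) , (# 2 , # 11) , (# 5 , # 21))
  ∷ ((# 0 , # 0) , (# 2 , # 18) , (# 4 , # 21)) ∷ ((# 0 , # 0) , (# 4 , # 9) , (# 5 , # 31))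
  ∷ ((# 0 , # 0) , (# 2 , # 13) , (# 5 , # 2)) ∷ ((# 0 , # 0) , (# 3 , # 1) , (# 4 , # 7))
  ∷ ((# 0 , # 0) , (# 2 , # 6) , (# 4 , # 27)) ∷ ((# 0 , # 0) , (# 2 , # 28) , (# 3 , # 23))
  ∷ ((# 0 , # 0) , (# 3 , # 15) , (# 4 , # 17)) ∷ ((# 0 , # 0) , (# 2 , # 20) , (# 5 , # 7))
  ∷ ((# 0 , # 0) , (# 2 , # 1) , (# 3 , # 14)) ∷ ((# 0 , # 0) , (# 2 , # 14) , (# 5 , # 20))
  ∷ ((# 0 , # 0) , (# 2 , # 23) , (# 4 , # 30)) ∷ ((# 0 , # 0) , (# 3 , # 18) , (# 5 , # 9))
  ∷ ((# 0 , # 0) , (# 3 , # 4) , (# 5 , # 29)) ∷ ((# 0 , # 0) , (# 2 , # 10) , (# 3 , # 27))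
  ∷ ((# 2 , # 0) , (# 4 , # 11) , (# 5 , # 14)) ∷ ((# 2 , # 0) , (# 3 , # 18) , (# 4 , # 17))
  ∷ ((# 2 , # 0) , (# 3 , # 1) , (# 5 , # 2)) ∷ ((# 2 , # 0) , (# 4 , # 1) , (# 5 , # 18))
  ∷ ((# 3 , # 0) , (# 4 , # 13) , (# 5 , # 6)) ∷ ((# 2 , # 0) , (# 3 , # 22) , (# 5 , # 11))
  ∷ ((# 2 , # 0) , (# 4 , # 26) , (# 5 , # 13)) ∷ ((# 3 , # 0) , (# 4 , # 12) , (# 5 , # 7))
  ∷ ((# 2 , # 0) , (# 3 , # 11) , (# 5 , # 9)) ∷ ((# 3 , # 0) , (# 4 , # 11) , (# 5 , # 12))
  ∷ ((# 2 , # 0) , (# 3 , # 2) , (# 5 , # 20)) ∷ ((# 2 , # 0) , (# 4 , # 28) , (# 5 , # 27))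
  ∷ ((# 2 , # 0) , (# 4 , # 4) , (# 5 , # 30)) ∷ ((# 3 , # 0) , (# 4 , # 26) , (# 5 , # 3))
  ∷ ((# 2 , # 0) , (# 3 , # 9) , (# 5 , # 3)) ∷ ((# 3 , # 0) , (# 4 , # 22) , (# 5 , # 13))
  ∷ ((# 2 , # 0) , (# 4 , # 18) , (# 5 , # 25)) ∷ ((# 2 , # 0) , (# 4 , # 20) , (# 5 , # 22))
  ∷ ((# 3 , # 0) , (# 4 , # 3) , (# 5 , # 31)) ∷ ((# 3 , # 0) , (# 4 , # 25) , (# 5 , # 5))
  ∷ ((# 2 , # 0) , (# 3 , # 20) , (# 4 , # 29)) ∷ ((# 2 , # 0) , (# 3 , # 26) , (# 4 , # 13)) ∷ []

-- For each m the counting condition is decided by evaluation, and the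
-- development of the corresponding difference family is the design.
lemma3p5 : (m : ℕ) → m ≡ 2 ⊎ m ≡ 4 → SCHGDD 6 m 8
lemma3p5 .2 (inj₁ refl) = development-is-SCHGDD (countsCorrect⇒family (toWitness {a? = countsCorrect?} tt))
  where open Development 6 2 8 base₂
lemma3p5 .4 (inj₂ refl) = development-is-SCHGDD (countsCorrect⇒family (toWitness {a? = countsCorrect?} tt))
  where open Development 6 4 8 base₄
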